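{- For every positive integer $n$ with $n \equiv 0 \pmod 4$ or $n \equiv 1 \pmod 4$, the maximum number of forks in a chain--collider--fork decomposition of the transitive tournament $TT_n$ is $\frac{n}{4}(n-2)$ when $n$ is even, and $\frac{(n-1)^2}{4}$ when $n$ is odd.
   Context: The transitive tournament $TT_n$ has vertex set $\{v_1,\dots,v_n\}$ and arc set $\{(v_i,v_j): 1\le i<j\le n\}$ (an arc $(u,v)$ is written $u\to v$). A chain is a digraph on three distinct vertices with arcs $a\to b\to c$; a collider is one with arcs $a\to b\leftarrow c$; a fork is one with arcs $a\leftarrow b\to c$. A chain--collider--fork decomposition of $TT_n$ is a partition of the arc set of $TT_n$ into two-element sets of arcs, each of which forms (as a subdigraph) a chain, a collider, or a fork. -}

module Defs where

open import Data.Nat using (ℕ; zero; suc; _+_; _*_; _∸_; _/_; _%_)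
open import Data.Fin using (Fin) renaming (_<_ to _<ᶠ_)
open import Data.Product using (_×_; _,_; Σ-syntax; ∃-syntax; proj₁; proj₂)
open import Data.Sum using (_⊎_)
open import Data.List using (List; []; _∷_; concatMap)
open import Data.List.Relation.Unary.All using (All)
open import Data.List.Relation.Unary.Unique.Propositional using (Unique)
open import Data.List.Membership.Propositional using (_∈_)
open import Relation.Binary.PropositionalEquality using (_≡_; _≢_)

-- An arc u → v is an ordered pair (u , v) of vertices.
Arc : ℕ → Set
Arc n = Fin n × Fin n

IsArcTT : (n : ℕ) → Arc n → Set
IsArcTT n (i , j) = i <ᶠ j

Distinct3 : ∀ {n} → Fin n → Fin n → Fin n → Set
Distinct3 a b c = a ≢ b × b ≢ c × a ≢ c

-- A two-element set of arcs, represented as an (ordered) pair.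
ArcPair : ℕ → Set
ArcPair n = Arc n × Arc n

IsChain : ∀ {n} → ArcPair n → Set
IsChain {n} p = ∃[ a ] ∃[ b ] ∃[ c ] Distinct3 {n} a b c ×
  (p ≡ ((a , b) , (b , c)) ⊎ p ≡ ((b , c) , (a , b)))

IsCollider : ∀ {n} → ArcPair n → Set
IsCollider {n} p = ∃[ a ] ∃[ b ] ∃[ c ] Distinct3 {n} a b c ×
  p ≡ ((a , b) , (c , b))

IsFork : ∀ {n} → ArcPair n → Set
IsFork {n} p = ∃[ a ] ∃[ b ] ∃[ c ] Distinct3 {n} a b c ×
  p ≡ ((b , a) , (b , c))

data Shape : Set where
  chain collider fork : Shape

HasShape : ∀ {n} → Shape → ArcPair n → Set
HasShape chain    p = IsChain p
HasShape collider p = IsCollider p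
HasShape fork     p = IsFork p

arcsOf : ∀ {n} → List (Shape × ArcPair n) → List (Arc n)
arcsOf = concatMap (λ sp → proj₁ (proj₂ sp) ∷ proj₂ (proj₂ sp) ∷ [])

record CCFDecomposition (n : ℕ) : Set where
  field
    parts    : List (Shape × ArcPair n)
    shaped   : All (λ sp → HasShape (proj₁ sp) (proj₂ sp)) parts
    arcsTT   : All (IsArcTT n) (arcsOf parts)
    distinct : Unique (arcsOf parts)
    covers   : ∀ (a : Arc n) → IsArcTT n a → a ∈ arcsOf parts

-- number of parts labelled fork (the three shapes are mutually exclusive)
countForks : ∀ {n} → List (Shape × ArcPair n) → ℕ
countForks [] = zero
countForks ((fork , _) ∷ ps) = suc (countForks ps)
countForks ((chain , _) ∷ ps) = countForks ps
countForks ((collider , _) ∷ ps) = countForks ps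

numForks : ∀ {n} → CCFDecomposition n → ℕ
numForks D = countForks (CCFDecomposition.parts D)

maxForksValue : ℕ → ℕ
maxForksValue n with n % 2
... | zero = (n * (n ∸ 2)) / 4
... | suc _ = ((n ∸ 1) * (n ∸ 1)) / 4

{-# OPTIONS --safe #-}
-- A fork of TT_n consists of two out-arcs of its centre, and vertex i has n - 1 - i out-arcs, so
-- a decomposition has at most Σ_{m<n} ⌊ m /2⌋ forks; this sum equals maxForksValue n for every n.
-- Conversely, build TT_(m+1) from TT_m by adding a new source and pairing its out-arcs into forks.
-- When m is odd, one out-arc (to the last vertex) is left over. Over four steps starting from
-- a multiple of 4, the two leftover arcs end at the same vertex and form a collider, so the
-- bound is attained when n ≡ 0 or 1 (mod 4).
module Submission where

open import Defs
open import Data.Nat using (ℕ; zero; suc; _+_; _*_; _∸_; _%_; _/_; _≤_; _>_; z≤n; s≤s; ⌊_/2⌋)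
open import Data.Nat.Properties using (+-comm; +-suc; +-mono-≤; ⌊n/2⌋-mono; n≡⌊n+n/2⌋; *-assoc; module ≤-Reasoning)
open import Data.Nat.DivMod using (m≡m%n+[m/n]*n; m*n/n≡m; m*n%n≡0; [m+kn]%n≡m%n)
open import Data.Nat.Tactic.RingSolver using (solve-∀)
open import Data.Fin using (Fin; zero; suc; fromℕ) renaming (_<_ to _<ᶠ_)
open import Data.Fin.Properties using (suc-injective; injective⇒≤)
open import Data.Product using (_×_; _,_; proj₁; proj₂; ∃-syntax; Σ-syntax)
import Data.Product as Product
open import Data.Sum using (_⊎_; inj₁; inj₂)
import Data.Sum as Sum
open import Data.List using (List; []; _∷_; [_]; _++_; length; map; allFin; lookup; tabulate)
open import Data.List.Properties using (length-map; map-++; ++-assoc; ++-identityʳ; map-tabulate)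
open import Data.List.Relation.Unary.All using (All; []; _∷_)
import Data.List.Relation.Unary.All as All
import Data.List.Relation.Unary.All.Properties as Allₚ
open import Data.List.Relation.Unary.AllPairs using ([]; _∷_)
open import Data.List.Relation.Unary.Unique.Propositional using (Unique)
import Data.List.Relation.Unary.Unique.Propositional.Properties as Unique
open import Data.List.Membership.Propositional using (_∈_)
open import Data.List.Membership.Propositional.Properties using (∈-lookup; ∈-map⁺; ∈-map⁻; ∈-++⁺ˡ; ∈-++⁺ʳ; ∈-allFin)
open import Data.List.Relation.Binary.Sublist.Propositional using (_⊆_; _⊇_; []; _∷_; _∷ʳ_; ⊆-refl)
open import Data.List.Relation.Binary.Sublist.Propositional.Properties using (All-resp-⊆; ++⁺ʳ)
open import Data.List.Relation.Binary.Permutation.Propositional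
  using (_↭_; ↭-refl; ↭-sym; ↭-trans; ↭-reflexive; ↭⇒↭ₛ; module PermutationReasoning)
import Data.List.Relation.Binary.Permutation.Propositional.Properties as Perm
import Data.List.Relation.Binary.Permutation.Setoid.Properties as PermSetoid
open import Data.Empty using (⊥; ⊥-elim)
open import Function using (_∘_; id; Injective)
open import Relation.Binary using (_Respects_)
open import Relation.Binary.PropositionalEquality
  using (_≡_; _≢_; refl; sym; trans; cong; cong₂; subst; resp₂; setoid; module ≡-Reasoning)

module _ {A : Set} where

  flatten : List (A × A) → List A
  flatten [] = []
  flatten ((x , y) ∷ ps) = x ∷ y ∷ flatten ps

  length-flatten : (ps : List (A × A)) → length (flatten ps) ≡ length ps + length ps
  length-flatten [] = refl
  length-flatten (_ ∷ ps) = cong suc (trans (cong suc (length-flatten ps)) (sym (+-suc _ _)))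

  Unique-resp-⊆ : Unique {A = A} Respects _⊇_
  Unique-resp-⊆ [] [] = []
  Unique-resp-⊆ (_ ∷ʳ τ) (_ ∷ u) = Unique-resp-⊆ τ u
  Unique-resp-⊆ (refl ∷ τ) (x∉ ∷ u) = All-resp-⊆ τ x∉ ∷ Unique-resp-⊆ τ u

  Unique-resp-↭ : Unique {A = A} Respects _↭_
  Unique-resp-↭ p = PermSetoid.AllPairs-resp-↭ (setoid A) (_∘ sym) (resp₂ _≢_) (↭⇒↭ₛ p)

  lookup-injective : ∀ {xs : List A} → Unique xs → Injective _≡_ _≡_ (lookup xs)
  lookup-injective {_ ∷ _} _ {zero} {zero} _ = refl
  lookup-injective {_ ∷ _} (x∉ ∷ _) {zero} {suc j} eq = ⊥-elim (All.lookup x∉ (∈-lookup j) eq)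
  lookup-injective {_ ∷ _} (x∉ ∷ _) {suc i} {zero} eq = ⊥-elim (All.lookup x∉ (∈-lookup i) (sym eq))
  lookup-injective {_ ∷ _} (_ ∷ u) {suc i} {suc j} eq = cong suc (lookup-injective u eq)

  ++-interchange : (as bs cs ds : List A) → (as ++ bs) ++ (cs ++ ds) ↭ (as ++ cs) ++ (bs ++ ds)
  ++-interchange as bs cs ds = begin
    (as ++ bs) ++ (cs ++ ds)  ≡⟨ ++-assoc as bs (cs ++ ds) ⟩
    as ++ (bs ++ cs ++ ds)    ↭⟨ Perm.++⁺ˡ as (Perm.shifts bs cs) ⟩
    as ++ (cs ++ bs ++ ds)    ≡⟨ ++-assoc as cs (bs ++ ds) ⟨
    (as ++ cs) ++ (bs ++ ds)  ∎
    where open PermutationReasoning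

both : ∀ {A B : Set} → (A → B) → A × A → B × B
both f = Product.map f f

flatten-map : ∀ {A B : Set} (f : A → B) (ps : List (A × A)) → flatten (map (both f) ps) ≡ map f (flatten ps)
flatten-map f [] = refl
flatten-map f ((x , y) ∷ ps) = cong (λ zs → f x ∷ f y ∷ zs) (flatten-map f ps)

Unique⇒length≤ : ∀ {n} {xs : List (Fin n)} → Unique xs → length xs ≤ n
Unique⇒length≤ u = injective⇒≤ (lookup-injective u)

pairs-length≤ : ∀ {m} (ps : List (Fin m × Fin m)) → Unique (flatten ps) → length ps ≤ ⌊ m /2⌋
pairs-length≤ {m} ps u = begin
  length ps                         ≡⟨ n≡⌊n+n/2⌋ (length ps) ⟩
  ⌊ length ps + length ps /2⌋       ≡⟨ cong ⌊_/2⌋ (length-flatten ps) ⟨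
  ⌊ length (flatten ps) /2⌋         ≤⟨ ⌊n/2⌋-mono (Unique⇒length≤ u) ⟩
  ⌊ m /2⌋                           ∎
  where open ≤-Reasoning

halfSums : ℕ → ℕ
halfSums zero = 0
halfSums (suc m) = halfSums m + ⌊ m /2⌋

⌊n*2/2⌋≡n : ∀ n → ⌊ n * 2 /2⌋ ≡ n
⌊n*2/2⌋≡n zero = refl
⌊n*2/2⌋≡n (suc n) = cong suc (⌊n*2/2⌋≡n n)

⌊1+n*2/2⌋≡n : ∀ n → ⌊ suc (n * 2) /2⌋ ≡ n
⌊1+n*2/2⌋≡n zero = refl
⌊1+n*2/2⌋≡n (suc n) = cong suc (⌊1+n*2/2⌋≡n n)

halfSums-odd : ∀ h → halfSums (suc (h * 2)) ≡ h * h
halfSums-odd zero = refl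
halfSums-odd (suc h) = begin
  halfSums (suc (suc h * 2))
    ≡⟨⟩
  (halfSums (suc (h * 2)) + ⌊ suc (h * 2) /2⌋) + ⌊ suc h * 2 /2⌋
    ≡⟨ cong₂ _+_ (cong₂ _+_ (halfSums-odd h) (⌊1+n*2/2⌋≡n h)) (⌊n*2/2⌋≡n (suc h)) ⟩
  (h * h + h) + suc h
    ≡⟨ square-suc h ⟩
  suc h * suc h ∎
  where
  open ≡-Reasoning
  square-suc : ∀ h → (h * h + h) + suc h ≡ suc h * suc h
  square-suc = solve-∀

halfSums-even : ∀ h → halfSums (suc h * 2) ≡ h * h + h
halfSums-even h = cong₂ _+_ (halfSums-odd h) (⌊1+n*2/2⌋≡n h)

maxForksValue-even : ∀ n → n % 2 ≡ 0 → maxForksValue n ≡ n * (n ∸ 2) / 4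
maxForksValue-even n n%2≡0 with n % 2
maxForksValue-even n refl | .0 = refl

maxForksValue-odd : ∀ n → n % 2 ≡ 1 → maxForksValue n ≡ (n ∸ 1) * (n ∸ 1) / 4
maxForksValue-odd n n%2≡1 with n % 2
maxForksValue-odd n refl | .1 = refl

even-or-odd : ∀ n → ∃[ h ] (n ≡ h * 2 ⊎ n ≡ suc (h * 2))
even-or-odd zero = 0 , inj₁ refl
even-or-odd (suc zero) = 0 , inj₂ refl
even-or-odd (suc (suc n)) with even-or-odd n
... | h , inj₁ refl = suc h , inj₁ refl
... | h , inj₂ refl = suc h , inj₂ refl

maxForksValue≡halfSums : ∀ n → maxForksValue n ≡ halfSums n
maxForksValue≡halfSums n with even-or-odd n
... | zero , inj₁ refl = refl
... | suc h , inj₁ refl = begin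
  maxForksValue (suc h * 2)          ≡⟨ maxForksValue-even (suc h * 2) (m*n%n≡0 (suc h) 2) ⟩
  suc h * 2 * (h * 2) / 4            ≡⟨ cong (_/ 4) (times-four h) ⟩
  (h * h + h) * 4 / 4                ≡⟨ m*n/n≡m (h * h + h) 4 ⟩
  h * h + h                          ≡⟨ halfSums-even h ⟨
  halfSums (suc h * 2)               ∎
  where
  open ≡-Reasoning
  times-four : ∀ h → suc h * 2 * (h * 2) ≡ (h * h + h) * 4
  times-four = solve-∀
... | h , inj₂ refl = begin
  maxForksValue (suc (h * 2))        ≡⟨ maxForksValue-odd (suc (h * 2)) ([m+kn]%n≡m%n 1 h 2) ⟩
  h * 2 * (h * 2) / 4                ≡⟨ cong (_/ 4) (times-four h) ⟩
  h * h * 4 / 4                      ≡⟨ m*n/n≡m (h * h) 4 ⟩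
  h * h                              ≡⟨ halfSums-odd h ⟨
  halfSums (suc (h * 2))             ∎
  where
  open ≡-Reasoning
  times-four : ∀ h → h * 2 * (h * 2) ≡ h * h * 4
  times-four = solve-∀

outOfZero : ∀ {m} → Fin m → Arc (suc m)
outOfZero j = zero , suc j

liftArc : ∀ {m} → Arc m → Arc (suc m)
liftArc = both suc

ttArcs : (n : ℕ) → List (Arc n)
ttArcs zero = []
ttArcs (suc m) = map outOfZero (allFin m) ++ map liftArc (ttArcs m)

ttArcs-forward : ∀ n → All (IsArcTT n) (ttArcs n)
ttArcs-forward zero = []
ttArcs-forward (suc m) =
  Allₚ.++⁺ (Allₚ.map⁺ (All.universal (λ _ → s≤s z≤n) (allFin m)))
           (Allₚ.map⁺ (All.map lift-forward (ttArcs-forward m)))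
  where
  lift-forward : ∀ {a} → IsArcTT m a → IsArcTT (suc m) (liftArc a)
  lift-forward i<j = s≤s i<j

ttArcs-unique : ∀ n → Unique (ttArcs n)
ttArcs-unique zero = []
ttArcs-unique (suc m) =
  Unique.++⁺ (Unique.map⁺ outOfZero-injective (Unique.allFin⁺ m))
             (Unique.map⁺ liftArc-injective (ttArcs-unique m))
             disjoint
  where
  outOfZero-injective : ∀ {i j : Fin m} → outOfZero i ≡ outOfZero j → i ≡ j
  outOfZero-injective refl = refl
  liftArc-injective : ∀ {a b : Arc m} → liftArc a ≡ liftArc b → a ≡ b
  liftArc-injective {_ , _} {_ , _} refl = refl
  disjoint : ∀ {a} → a ∈ map outOfZero (allFin m) × a ∈ map liftArc (ttArcs m) → ⊥
  disjoint (p , q) with ∈-map⁻ outOfZero p | ∈-map⁻ liftArc q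
  ... | _ , _ , refl | (_ , _) , _ , ()

ttArcs-complete : ∀ n (a : Arc n) → IsArcTT n a → a ∈ ttArcs n
ttArcs-complete (suc m) (zero , suc j) _ = ∈-++⁺ˡ (∈-map⁺ outOfZero (∈-allFin j))
ttArcs-complete (suc m) (suc i , suc j) (s≤s i<j) =
  ∈-++⁺ʳ _ (∈-map⁺ liftArc (ttArcs-complete m (i , j) i<j))

-- Forks whose centre precedes both leaves: `fromZero a c` is 0 → suc a, 0 → suc c, and `lift`
-- shifts every vertex up by one.
data Fork : ℕ → Set where
  fromZero : ∀ {m} → Fin m → Fin m → Fork (suc m)
  lift     : ∀ {m} → Fork m → Fork (suc m)

legs : ∀ {n} → Fork n → ArcPair n
legs (fromZero a c) = outOfZero a , outOfZero c
legs (lift f) = both liftArc (legs f)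

forkArcs : ∀ {n} → List (Fork n) → List (Arc n)
forkArcs fs = flatten (map legs fs)

module _ {m : ℕ} where

  pairsAtZero : List (Fork (suc m)) → List (Fin m × Fin m)
  pairsAtZero [] = []
  pairsAtZero (fromZero a c ∷ fs) = (a , c) ∷ pairsAtZero fs
  pairsAtZero (lift _ ∷ fs) = pairsAtZero fs

  lowered : List (Fork (suc m)) → List (Fork m)
  lowered [] = []
  lowered (fromZero _ _ ∷ fs) = lowered fs
  lowered (lift f ∷ fs) = f ∷ lowered fs

  length-pairsAtZero+lowered : ∀ fs → length fs ≡ length (pairsAtZero fs) + length (lowered fs)
  length-pairsAtZero+lowered [] = refl
  length-pairsAtZero+lowered (fromZero _ _ ∷ fs) = cong suc (length-pairsAtZero+lowered fs)
  length-pairsAtZero+lowered (lift _ ∷ fs) =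
    trans (cong suc (length-pairsAtZero+lowered fs)) (sym (+-suc _ _))

  pairsAtZero-⊆ : ∀ fs → map outOfZero (flatten (pairsAtZero fs)) ⊆ forkArcs fs
  pairsAtZero-⊆ [] = []
  pairsAtZero-⊆ (fromZero _ _ ∷ fs) = refl ∷ refl ∷ pairsAtZero-⊆ fs
  pairsAtZero-⊆ (lift _ ∷ fs) = _ ∷ʳ _ ∷ʳ pairsAtZero-⊆ fs

  lowered-⊆ : ∀ fs → map liftArc (forkArcs (lowered fs)) ⊆ forkArcs fs
  lowered-⊆ [] = []
  lowered-⊆ (fromZero _ _ ∷ fs) = _ ∷ʳ _ ∷ʳ lowered-⊆ fs
  lowered-⊆ (lift _ ∷ fs) = refl ∷ refl ∷ lowered-⊆ fs

forks≤halfSums : ∀ {n} (fs : List (Fork n)) → Unique (forkArcs fs) → length fs ≤ halfSums n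
forks≤halfSums {zero} [] _ = z≤n
forks≤halfSums {suc m} fs u = begin
  length fs                                     ≡⟨ length-pairsAtZero+lowered fs ⟩
  length (pairsAtZero fs) + length (lowered fs) ≤⟨ +-mono-≤ atZero≤ lowered≤ ⟩
  ⌊ m /2⌋ + halfSums m                          ≡⟨ +-comm ⌊ m /2⌋ (halfSums m) ⟩
  halfSums (suc m)                              ∎
  where
  open ≤-Reasoning
  atZero≤ : length (pairsAtZero fs) ≤ ⌊ m /2⌋
  atZero≤ = pairs-length≤ (pairsAtZero fs) (Unique.map⁻ (Unique-resp-⊆ (pairsAtZero-⊆ fs) u))
  lowered≤ : length (lowered fs) ≤ halfSums m
  lowered≤ = forks≤halfSums (lowered fs) (Unique.map⁻ (Unique-resp-⊆ (lowered-⊆ fs) u))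

toFork : ∀ {n} {b a c : Fin n} → b <ᶠ a → b <ᶠ c → Fork n
toFork {b = zero}  {suc a} {suc c} _ _ = fromZero a c
toFork {b = suc b} {suc a} {suc c} (s≤s b<a) (s≤s b<c) = lift (toFork b<a b<c)
toFork {b = zero}  {zero}  () _
toFork {b = zero}  {suc _} {zero} _ ()
toFork {b = suc _} {zero}  () _
toFork {b = suc _} {suc _} {zero} _ ()

legs-toFork : ∀ {n} {b a c : Fin n} (b<a : b <ᶠ a) (b<c : b <ᶠ c) →
              legs (toFork b<a b<c) ≡ ((b , a) , (b , c))
legs-toFork {b = zero}  {suc a} {suc c} _ _ = refl
legs-toFork {b = suc b} {suc a} {suc c} (s≤s b<a) (s≤s b<c) = cong (both liftArc) (legs-toFork b<a b<c)
legs-toFork {b = zero}  {zero}  () _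
legs-toFork {b = zero}  {suc _} {zero} _ ()
legs-toFork {b = suc _} {zero}  () _
legs-toFork {b = suc _} {suc _} {zero} _ ()

WellShaped : ∀ {n} → List (Shape × ArcPair n) → Set
WellShaped = All (λ sp → HasShape (proj₁ sp) (proj₂ sp))

module _ {n : ℕ} where

  forksOf : (ps : List (Shape × ArcPair n)) → WellShaped ps → All (IsArcTT n) (arcsOf ps) → List (Fork n)
  forksOf [] [] [] = []
  forksOf ((fork , _) ∷ ps) ((_ , _ , _ , _ , refl) ∷ sh) (b<a ∷ b<c ∷ fw) = toFork b<a b<c ∷ forksOf ps sh fw
  forksOf ((chain , _) ∷ ps) (_ ∷ sh) (_ ∷ _ ∷ fw) = forksOf ps sh fw
  forksOf ((collider , _) ∷ ps) (_ ∷ sh) (_ ∷ _ ∷ fw) = forksOf ps sh fw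

  countForks≡length-forksOf : ∀ ps sh fw → countForks ps ≡ length (forksOf ps sh fw)
  countForks≡length-forksOf [] [] [] = refl
  countForks≡length-forksOf ((fork , _) ∷ ps) ((_ , _ , _ , _ , refl) ∷ sh) (_ ∷ _ ∷ fw) =
    cong suc (countForks≡length-forksOf ps sh fw)
  countForks≡length-forksOf ((chain , _) ∷ ps) (_ ∷ sh) (_ ∷ _ ∷ fw) = countForks≡length-forksOf ps sh fw
  countForks≡length-forksOf ((collider , _) ∷ ps) (_ ∷ sh) (_ ∷ _ ∷ fw) = countForks≡length-forksOf ps sh fw

  forksOf-⊆ : ∀ ps sh fw → forkArcs (forksOf ps sh fw) ⊆ arcsOf ps
  forksOf-⊆ [] [] [] = []
  forksOf-⊆ ((fork , _) ∷ ps) ((_ , _ , _ , _ , refl) ∷ sh) (b<a ∷ b<c ∷ fw) =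
    cong proj₁ (legs-toFork b<a b<c) ∷ cong proj₂ (legs-toFork b<a b<c) ∷ forksOf-⊆ ps sh fw
  forksOf-⊆ ((chain , _) ∷ ps) (_ ∷ sh) (_ ∷ _ ∷ fw) = _ ∷ʳ _ ∷ʳ forksOf-⊆ ps sh fw
  forksOf-⊆ ((collider , _) ∷ ps) (_ ∷ sh) (_ ∷ _ ∷ fw) = _ ∷ʳ _ ∷ʳ forksOf-⊆ ps sh fw

numForks≤halfSums : ∀ {n} (D : CCFDecomposition n) → numForks D ≤ halfSums n
numForks≤halfSums {n} D = begin
  countForks parts           ≡⟨ countForks≡length-forksOf parts shaped arcsTT ⟩
  length fs                  ≤⟨ forks≤halfSums fs (Unique-resp-⊆ (forksOf-⊆ parts shaped arcsTT) distinct) ⟩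
  halfSums n                 ∎
  where
  open ≤-Reasoning
  open CCFDecomposition D
  fs : List (Fork n)
  fs = forksOf parts shaped arcsTT

suc² : ∀ {m} → Fin m → Fin (suc (suc m))
suc² i = suc (suc i)

vertexPairs : ∀ m → List (Fin m × Fin m)
vertexPairs zero = []
vertexPairs (suc zero) = []
vertexPairs (suc (suc m)) = (zero , suc zero) ∷ map (both suc²) (vertexPairs m)

unpaired : ∀ m → List (Fin m)
unpaired zero = []
unpaired (suc zero) = [ zero ]
unpaired (suc (suc m)) = map suc² (unpaired m)

vertexPairs-partition : ∀ m → flatten (vertexPairs m) ++ unpaired m ≡ allFin m
vertexPairs-partition zero = refl
vertexPairs-partition (suc zero) = refl
vertexPairs-partition (suc (suc m)) = cong (λ vs → zero ∷ suc zero ∷ vs) (begin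
  flatten (map (both suc²) (vertexPairs m)) ++ map suc² (unpaired m)
    ≡⟨ cong (_++ map suc² (unpaired m)) (flatten-map suc² (vertexPairs m)) ⟩
  map suc² (flatten (vertexPairs m)) ++ map suc² (unpaired m)
    ≡⟨ map-++ suc² (flatten (vertexPairs m)) (unpaired m) ⟨
  map suc² (flatten (vertexPairs m) ++ unpaired m)
    ≡⟨ cong (map suc²) (vertexPairs-partition m) ⟩
  map suc² (allFin m)
    ≡⟨ map-tabulate id suc² ⟩
  tabulate suc² ∎)
  where open ≡-Reasoning

vertexPairs-unique : ∀ m → Unique (flatten (vertexPairs m))
vertexPairs-unique m =
  Unique-resp-⊆ (++⁺ʳ (unpaired m) ⊆-refl) (subst Unique (sym (vertexPairs-partition m)) (Unique.allFin⁺ m))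

length-vertexPairs : ∀ m → length (vertexPairs m) ≡ ⌊ m /2⌋
length-vertexPairs zero = refl
length-vertexPairs (suc zero) = refl
length-vertexPairs (suc (suc m)) = cong suc (trans (length-map _ (vertexPairs m)) (length-vertexPairs m))

unpaired-even : ∀ h → unpaired (h * 2) ≡ []
unpaired-even zero = refl
unpaired-even (suc h) = cong (map suc²) (unpaired-even h)

unpaired-odd : ∀ h → unpaired (suc (h * 2)) ≡ [ fromℕ (h * 2) ]
unpaired-odd zero = refl
unpaired-odd (suc h) = cong (map suc²) (unpaired-odd h)

liftPart : ∀ {m} → Shape × ArcPair m → Shape × ArcPair (suc m)
liftPart = Product.map₂ (both liftArc)

liftDistinct3 : ∀ {m} {a b c : Fin m} → Distinct3 a b c → Distinct3 (suc a) (suc b) (suc c)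
liftDistinct3 (a≢b , b≢c , a≢c) = a≢b ∘ suc-injective , b≢c ∘ suc-injective , a≢c ∘ suc-injective

liftShape : ∀ {m} s {p : ArcPair m} → HasShape s p → HasShape s (both liftArc p)
liftShape chain    (a , b , c , d , e) =
  suc a , suc b , suc c , liftDistinct3 d , Sum.map (cong (both liftArc)) (cong (both liftArc)) e
liftShape collider (a , b , c , d , e) = suc a , suc b , suc c , liftDistinct3 d , cong (both liftArc) e
liftShape fork     (a , b , c , d , e) = suc a , suc b , suc c , liftDistinct3 d , cong (both liftArc) e

module _ {m : ℕ} where

  liftParts-shaped : ∀ {ps : List (Shape × ArcPair m)} → WellShaped ps → WellShaped (map liftPart ps)
  liftParts-shaped [] = []
  liftParts-shaped (sh ∷ shs) = liftShape _ sh ∷ liftParts-shaped shs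

  arcsOf-liftParts : (ps : List (Shape × ArcPair m)) → arcsOf (map liftPart ps) ≡ map liftArc (arcsOf ps)
  arcsOf-liftParts [] = refl
  arcsOf-liftParts (_ ∷ ps) = cong (λ as → _ ∷ _ ∷ as) (arcsOf-liftParts ps)

  countForks-liftParts : (ps : List (Shape × ArcPair m)) → countForks (map liftPart ps) ≡ countForks ps
  countForks-liftParts [] = refl
  countForks-liftParts ((chain , _) ∷ ps) = countForks-liftParts ps
  countForks-liftParts ((collider , _) ∷ ps) = countForks-liftParts ps
  countForks-liftParts ((fork , _) ∷ ps) = cong suc (countForks-liftParts ps)

  addForksAtZero : List (Fin m × Fin m) → List (Shape × ArcPair (suc m)) → List (Shape × ArcPair (suc m))
  addForksAtZero [] qs = qs
  addForksAtZero ((a , c) ∷ P) qs = (fork , (outOfZero a , outOfZero c)) ∷ addForksAtZero P qs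

  addForksAtZero-shaped : ∀ P {qs} → Unique (flatten P) → WellShaped qs → WellShaped (addForksAtZero P qs)
  addForksAtZero-shaped [] _ shs = shs
  addForksAtZero-shaped ((a , c) ∷ P) ((a≢c ∷ _) ∷ _ ∷ u) shs =
    (suc a , zero , suc c , ((λ ()) , (λ ()) , a≢c ∘ suc-injective) , refl) ∷ addForksAtZero-shaped P u shs

  arcsOf-addForksAtZero : ∀ P qs → arcsOf (addForksAtZero P qs) ≡ map outOfZero (flatten P) ++ arcsOf qs
  arcsOf-addForksAtZero [] qs = refl
  arcsOf-addForksAtZero (_ ∷ P) qs = cong (λ as → _ ∷ _ ∷ as) (arcsOf-addForksAtZero P qs)

  countForks-addForksAtZero : ∀ P qs → countForks (addForksAtZero P qs) ≡ length P + countForks qs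
  countForks-addForksAtZero [] qs = refl
  countForks-addForksAtZero (_ ∷ P) qs = cong suc (countForks-addForksAtZero P qs)

record OptimalPartial (m : ℕ) (leftover : List (Arc m)) : Set where
  field
    parts     : List (Shape × ArcPair m)
    shaped    : WellShaped parts
    partition : arcsOf parts ++ leftover ↭ ttArcs m
    forkCount : countForks parts ≡ halfSums m

-- The new source 0 becomes the centre of forks pairing up its out-arcs, all but one if m is odd.
extend : ∀ {m L} → OptimalPartial m L → OptimalPartial (suc m) (map outOfZero (unpaired m) ++ map liftArc L)
extend {m} {L} d = record
  { parts     = addForksAtZero P (map liftPart parts)
  ; shaped    = addForksAtZero-shaped P (vertexPairs-unique m) (liftParts-shaped shaped)
  ; partition = partition′
  ; forkCount = forkCount′
  }
  where
  open OptimalPartial d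
  P : List (Fin m × Fin m)
  P = vertexPairs m
  R : List (Fin m)
  R = unpaired m
  partition′ : arcsOf (addForksAtZero P (map liftPart parts)) ++ (map outOfZero R ++ map liftArc L) ↭ ttArcs (suc m)
  partition′ = begin
    arcsOf (addForksAtZero P (map liftPart parts)) ++ (map outOfZero R ++ map liftArc L)
      ≡⟨ cong (_++ _) (trans (arcsOf-addForksAtZero P _)
                              (cong (map outOfZero (flatten P) ++_) (arcsOf-liftParts parts))) ⟩
    (map outOfZero (flatten P) ++ map liftArc (arcsOf parts)) ++ (map outOfZero R ++ map liftArc L)
      ↭⟨ ++-interchange (map outOfZero (flatten P)) _ _ _ ⟩
    (map outOfZero (flatten P) ++ map outOfZero R) ++ (map liftArc (arcsOf parts) ++ map liftArc L)
      ≡⟨ cong₂ _++_ (map-++ outOfZero (flatten P) R) (map-++ liftArc (arcsOf parts) L) ⟨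
    map outOfZero (flatten P ++ R) ++ map liftArc (arcsOf parts ++ L)
      ↭⟨ Perm.++⁺ (↭-reflexive (cong (map outOfZero) (vertexPairs-partition m))) (Perm.map⁺ liftArc partition) ⟩
    ttArcs (suc m) ∎
    where open PermutationReasoning
  forkCount′ : countForks (addForksAtZero P (map liftPart parts)) ≡ halfSums (suc m)
  forkCount′ = begin
    countForks (addForksAtZero P (map liftPart parts))  ≡⟨ countForks-addForksAtZero P _ ⟩
    length P + countForks (map liftPart parts)          ≡⟨ cong₂ _+_ (length-vertexPairs m)
                                                                     (trans (countForks-liftParts parts) forkCount) ⟩
    ⌊ m /2⌋ + halfSums m                                ≡⟨ +-comm ⌊ m /2⌋ (halfSums m) ⟩
    halfSums (suc m)                                    ∎
    where open ≡-Reasoning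

absorbCollider : ∀ {m L} {a b c : Fin m} → Distinct3 a b c →
                 OptimalPartial m ((a , b) ∷ (c , b) ∷ L) → OptimalPartial m L
absorbCollider {a = a} {b} {c} d p = record
  { parts     = (collider , ((a , b) , (c , b))) ∷ parts
  ; shaped    = (a , b , c , d , refl) ∷ shaped
  ; partition = ↭-trans (Perm.shifts ((a , b) ∷ (c , b) ∷ []) (arcsOf parts)) partition
  ; forkCount = forkCount
  }
  where open OptimalPartial p

extendEven : ∀ h {L} → OptimalPartial (h * 2) L → OptimalPartial (suc (h * 2)) (map liftArc L)
extendEven h {L} d =
  subst (λ R → OptimalPartial _ (map outOfZero R ++ map liftArc L)) (unpaired-even h) (extend d)

extendOdd : ∀ h {L} → OptimalPartial (suc (h * 2)) L →
            OptimalPartial (suc h * 2) (outOfZero (fromℕ (h * 2)) ∷ map liftArc L)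
extendOdd h {L} d =
  subst (λ R → OptimalPartial _ (map outOfZero R ++ map liftArc L)) (unpaired-odd h) (extend d)

-- The two odd steps leave out the arcs 0 → last and (after one more lift) 2 → last, a collider.
block : ∀ h → OptimalPartial (h * 2) [] → OptimalPartial (suc (suc h) * 2) []
block h = absorbCollider ((λ ()) , (λ ()) , (λ ()))
        ∘ extendOdd (suc h) ∘ extendEven (suc h) ∘ extendOdd h ∘ extendEven h

optimalPartial-4k : ∀ k → OptimalPartial (k * 2 * 2) []
optimalPartial-4k zero = record { parts = [] ; shaped = [] ; partition = ↭-refl ; forkCount = refl }
optimalPartial-4k (suc k) = block (k * 2) (optimalPartial-4k k)

OptimalDecomposition : ℕ → Set
OptimalDecomposition n = Σ[ D ∈ CCFDecomposition n ] numForks D ≡ halfSums n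

fromOptimalPartial : ∀ {n} → OptimalPartial n [] → OptimalDecomposition n
fromOptimalPartial {n} d = D , forkCount
  where
  open OptimalPartial d
  ttArcs↭ : ttArcs n ↭ arcsOf parts
  ttArcs↭ = ↭-sym (↭-trans (↭-reflexive (sym (++-identityʳ (arcsOf parts)))) partition)
  D : CCFDecomposition n
  D = record
    { parts    = parts
    ; shaped   = shaped
    ; arcsTT   = Perm.All-resp-↭ ttArcs↭ (ttArcs-forward n)
    ; distinct = Unique-resp-↭ ttArcs↭ (ttArcs-unique n)
    ; covers   = λ a a-forward → Perm.∈-resp-↭ ttArcs↭ (ttArcs-complete n a a-forward)
    }

n≡r+n/4*2*2 : ∀ n {r} → n % 4 ≡ r → n ≡ r + n / 4 * 2 * 2
n≡r+n/4*2*2 n n%4≡r = trans (m≡m%n+[m/n]*n n 4) (cong₂ _+_ n%4≡r (sym (*-assoc (n / 4) 2 2)))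

optimalDecomposition : ∀ n → n % 4 ≡ 0 ⊎ n % 4 ≡ 1 → OptimalDecomposition n
optimalDecomposition n (inj₁ n%4≡0) =
  subst OptimalDecomposition (sym (n≡r+n/4*2*2 n n%4≡0)) (fromOptimalPartial (optimalPartial-4k (n / 4)))
optimalDecomposition n (inj₂ n%4≡1) =
  subst OptimalDecomposition (sym (n≡r+n/4*2*2 n n%4≡1))
        (fromOptimalPartial (extendEven (n / 4 * 2) (optimalPartial-4k (n / 4))))

mainTheorem8 : ∀ (n : ℕ) → n > 0 → (n % 4 ≡ 0 ⊎ n % 4 ≡ 1) →
    (∃[ D ] numForks {n} D ≡ maxForksValue n)
      × (∀ (D : CCFDecomposition n) → numForks D ≤ maxForksValue n)
mainTheorem8 n _ n%4 =
  Product.map₂ (λ optimal → trans optimal value) (optimalDecomposition n n%4) ,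
  λ D → subst (numForks D ≤_) value (numForks≤halfSums D)
  where
  value : halfSums n ≡ maxForksValue n
  value = sym (maxForksValue≡halfSums n)
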